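{- Every well-behaved defeasible logic is coherent.
   Context: A defeasible theory $D=(F,R,>)$ consists of a finite set $F$ of literals, a finite set $R$ of rules (each with a finite antecedent set of literals, a type strict/defeasible/defeater and a consequent literal) and an acyclic relation $>$ on $R$. Conclusions have the form $+d\,q$ or $-d\,q$ ($d$ a tag, $q$ a literal). A defeasible logic is a finite set of inference rules "We may append $\pm d\,q$ to $P$ if $C$", one per tag, some of which are designated as its main inference rules; a proof from $D$ is a finite sequence of conclusions each appendable by some rule to the sequence preceding it, and $D\vdash c$ if $c$ occurs in some proof from $D$. An applicability condition $C(D,q,P)$ is a first-order formula in negation normal form (negation only on atomic formulas; connectives $\wedge,\vee,\exists,\forall$; quantified variables range over syntactic elements of $D$ or numbers) whose atomic formulas are pure atomic formulas (comparisons of elements of $D$, arithmetic and set comparisons; no tagged literals, no $P$) or proof atomic formulas $\pm d'p\in X$ with $X$ either the current proof $P$ or a pre-defined set of conclusions computed from $D$; $c\notin X$ abbreviates $\neg(c\in X)$. Strong negation: $\mathrm{sneg}(+d p\in X)= -dp\in X$; $\mathrm{sneg}(-dp\in X)=+dp\in X$; $\mathrm{sneg}(+dp\notin X)=+dp\in X$; $\mathrm{sneg}(-dp\notin X)=-dp\in X$; $\mathrm{sneg}(A\wedge B)=\mathrm{sneg}(A)\vee\mathrm{sneg}(B)$; $\mathrm{sneg}(A\vee B)=\mathrm{sneg}(A)\wedge\mathrm{sneg}(B)$; $\mathrm{sneg}(\exists x\,A)=\forall x\,\mathrm{sneg}(A)$; $\mathrm{sneg}(\forall x\,A)=\exists x\,\mathrm{sneg}(A)$;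 $\mathrm{sneg}(\neg A)=A$ and $\mathrm{sneg}(A)=\neg A$ for pure atomic $A$. The logic supports the (revised) Principle of Strong Negation if for every tag $d$, when the $+d$ rule has applicability condition $C$, the $-d$ rule has applicability condition $\mathrm{sneg}(C)$. An inference rule is stable if for every proof $P$ and every proof $Q$ containing $P$ as a subsequence, $C(P)\rightarrow C(Q)$. A set $I$ of inference rules is reference-closed if whenever a rule in $I$ refers to a conclusion with tag $t$, the rule with tag $t$ is in $I$. For a set $J$ of rules with $I$ the smallest reference-closed set containing $J$, the $J$-closure is the set of conclusions with tags in $J$ belonging to the smallest set of conclusions closed under inference by rules of $I$; it is even-handed if $J$ contains the $-d$ rule whenever it contains the $+d$ rule and vice versa. A set $S$ of conclusions is coherent if no tag $d$ and literal $q$ have $\{+dq,-dq\}\subseteq S$. A logic is well-behaved if all its inference rules are stable, it supports the revised Principle of Strong Negation, and all pre-defined sets used in its inference rules are coherent even-handed closures. A tag $d$ is coherent if for no $D$ and literal $q$ both $D\vdash +dq$ and $D\vdash -dq$; a logic is coherent if its main inference rules (tags) are coherent. -}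

module Defs where

open import Data.Nat using (ℕ)
open import Data.Fin using (Fin)
open import Data.Bool using (Bool; true)
open import Data.List using (List; []; _∷_; _∷ʳ_)
open import Data.List.Membership.Propositional using (_∈_)
open import Data.List.Relation.Binary.Sublist.Propositional using (_⊆_)
open import Data.Product using (Σ; _×_; _,_)
open import Data.Sum using (_⊎_)
open import Data.Empty using (⊥)
open import Relation.Nullary using (¬_)
open import Relation.Binary.PropositionalEquality using (_≡_)

data Lit : Set where
  pos neg : ℕ → Lit

data RuleType : Set where
  strict defeasible defeater : RuleType

-- A rule: a label (so that distinct rules may share antecedent/type/head),
-- a finite antecedent set of literals, a type and a consequent literal.
record Rule : Set where
  constructor mkRule
  field
    label      : ℕ
    antecedent : List Lit
    type       : RuleType
    consequent : Lit

data Sup⁺ (sup : List (Rule × Rule)) : Rule → Rule → Set where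
  one  : ∀ {r s} → (r , s) ∈ sup → Sup⁺ sup r s
  more : ∀ {r s t} → (r , s) ∈ sup → Sup⁺ sup s t → Sup⁺ sup r t

record Theory : Set where
  field
    facts   : List Lit
    rules   : List Rule
    sup     : List (Rule × Rule)
    sup-on-rules : ∀ {r s} → (r , s) ∈ sup → (r ∈ rules) × (s ∈ rules)
    acyclic : ∀ r → ¬ Sup⁺ sup r r

data Sign : Set where
  plus minus : Sign

flipSign : Sign → Sign
flipSign plus  = minus
flipSign minus = plus

record Concl (n : ℕ) : Set where
  constructor ⟨_,_,_⟩
  field
    sign : Sign
    tag  : Fin n
    lit  : Lit
open Concl public

-- Applicability conditions: first-order formulas in negation normal form

data Val : Set where
  vlit  : Lit → Val
  vrule : Rule → Val
  vnum  : ℕ → Val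

-- a set of conclusions referred to in a proof atom:
-- the current proof P, or the k-th pre-defined set
data Src (m : ℕ) : Set where
  current : Src m
  pre     : Fin m → Src m

-- terms/pure atoms may depend on D, on the literal q, and on the values of
-- the bound variables (de Bruijn environment); they never depend on P.
Term : Set
Term = Theory → Lit → List Val → Lit

PureAtom : Set₁
PureAtom = Theory → Lit → List Val → Set

data Form (n m : ℕ) : Set₁ where
  pure  : PureAtom → Form n m
  npure : PureAtom → Form n m
  mem   : Sign → Fin n → Term → Src m → Form n m
  nmem  : Sign → Fin n → Term → Src m → Form n m
  and   : Form n m → Form n m → Form n m
  or    : Form n m → Form n m → Form n m
  ex    : Form n m → Form n m
  all   : Form n m → Form n m

sneg : ∀ {n m} → Form n m → Form n m
sneg (pure A)       = npure A
sneg (npure A)      = pure A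
sneg (mem s d t X)  = mem (flipSign s) d t X
sneg (nmem s d t X) = mem s d t X
sneg (and A B)      = or (sneg A) (sneg B)
sneg (or A B)       = and (sneg A) (sneg B)
sneg (ex A)         = all (sneg A)
sneg (all A)        = ex (sneg A)

srcSet : ∀ {n m} → Src m → (Fin m → Concl n → Set) → (Concl n → Set) → Concl n → Set
srcSet current   pres cur = cur
srcSet (pre k)   pres cur = pres k

Sem : ∀ {n m} → Form n m → (Fin m → Concl n → Set) → (Concl n → Set)
      → Theory → Lit → List Val → Set
Sem (pure A)       pres cur D q ρ = A D q ρ
Sem (npure A)      pres cur D q ρ = ¬ A D q ρ
Sem (mem s d t X)  pres cur D q ρ = srcSet X pres cur ⟨ s , d , t D q ρ ⟩
Sem (nmem s d t X) pres cur D q ρ = ¬ srcSet X pres cur ⟨ s , d , t D q ρ ⟩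
Sem (and A B)      pres cur D q ρ = Sem A pres cur D q ρ × Sem B pres cur D q ρ
Sem (or A B)       pres cur D q ρ = Sem A pres cur D q ρ ⊎ Sem B pres cur D q ρ
Sem (ex A)         pres cur D q ρ = Σ Val λ v → Sem A pres cur D q (v ∷ ρ)
Sem (all A)        pres cur D q ρ = (v : Val) → Sem A pres cur D q (v ∷ ρ)

Refers : ∀ {n m} → Form n m → Sign → Fin n → Set
Refers (pure A)       s' t = ⊥
Refers (npure A)      s' t = ⊥
Refers (mem s d _ _)  s' t = (s ≡ s') × (d ≡ t)
Refers (nmem s d _ _) s' t = (s ≡ s') × (d ≡ t)
Refers (and A B)      s' t = Refers A s' t ⊎ Refers B s' t
Refers (or A B)       s' t = Refers A s' t ⊎ Refers B s' t
Refers (ex A)         s' t = Refers A s' t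
Refers (all A)        s' t = Refers A s' t

-- Defeasible logics: one inference rule per signed tag ±d (d : Fin n),
-- m pre-defined sets of conclusions computed from D.

record Logic (n m : ℕ) : Set₁ where
  field
    cond   : Sign → Fin n → Form n m
    main   : Sign → Fin n → Bool
    predef : Fin m → Theory → Concl n → Set

module _ {n m : ℕ} (L : Logic n m) where
  open Logic L

  -- C(D, q, X) for the ±d rule, with "P" interpreted as the set cur
  Holds : Sign → Fin n → Theory → Lit → (Concl n → Set) → Set
  Holds s d D q cur = Sem (cond s d) (λ k → predef k D) cur D q []

  Appendable : Theory → List (Concl n) → Concl n → Set
  Appendable D P c = Holds (sign c) (tag c) D (lit c) (_∈ P)

  data IsProof (D : Theory) : List (Concl n) → Set where
    nil  : IsProof D []
    snoc : ∀ {P c} → IsProof D P → Appendable D P c → IsProof D (P ∷ʳ c)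

  _⊢_ : Theory → Concl n → Set
  D ⊢ c = Σ (List (Concl n)) λ P → IsProof D P × (c ∈ P)

  Stable : Sign → Fin n → Set
  Stable s d = ∀ (D : Theory) (q : Lit) (P Q : List (Concl n))
             → IsProof D P → IsProof D Q → P ⊆ Q
             → Holds s d D q (_∈ P) → Holds s d D q (_∈ Q)

  StrongNegation : Set₁
  StrongNegation = ∀ d → cond minus d ≡ sneg (cond plus d)

  data RefClosure (J : Sign → Fin n → Set) : Sign → Fin n → Set where
    base : ∀ {s d} → J s d → RefClosure J s d
    step : ∀ {s d s' t} → RefClosure J s d → Refers (cond s d) s' t → RefClosure J s' t

  ClosedUnder : (Sign → Fin n → Set) → Theory → (Concl n → Set) → Set
  ClosedUnder I D S = ∀ s d q → I s d → Holds s d D q S → S ⟨ s , d , q ⟩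

  IsClosure : (Sign → Fin n → Set) → Theory → (Concl n → Set) → Set₁
  IsClosure J D X =
    Σ (Concl n → Set) λ S →
        ClosedUnder (RefClosure J) D S
      × (∀ S' → ClosedUnder (RefClosure J) D S' → ∀ c → S c → S' c)
      × (∀ c → (X c → J (sign c) (tag c) × S c) × (J (sign c) (tag c) × S c → X c))

  EvenHanded : (Sign → Fin n → Set) → Set
  EvenHanded J = ∀ d → (J plus d → J minus d) × (J minus d → J plus d)

  WellBehaved : Set₁
  WellBehaved =
      (∀ s d → Stable s d)
    × StrongNegation
    × (∀ k → Σ (Sign → Fin n → Set) λ J →
             EvenHanded J
           × (∀ D → IsClosure J D (predef k D) × CoherentSet (predef k D)))
    where
    CoherentSet : (Concl n → Set) → Set
    CoherentSet X = ∀ d q → ¬ (X ⟨ plus , d , q ⟩ × X ⟨ minus , d , q ⟩)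

  CoherentTag : Fin n → Set
  CoherentTag d = ∀ (D : Theory) (q : Lit) → ¬ ((D ⊢ ⟨ plus , d , q ⟩) × (D ⊢ ⟨ minus , d , q ⟩))

  Coherent : Set
  Coherent = ∀ d → (main plus d ≡ true ⊎ main minus d ≡ true) → CoherentTag d

-- Strong negation makes the applicability conditions of +d and −d mutually
-- exclusive on any coherent set of conclusions whenever the pre-defined sets are
-- coherent. Stability keeps every step of a proof applicable at its end, so by
-- induction every proof is coherent; two proofs of +dq and −dq concatenate, again
-- by stability, into a single proof containing both.
module Submission where

open import Defs
open import Data.Nat using (ℕ)
open import Data.Fin using (Fin)
open import Data.List using ([]; _∷_; _++_; [_])
open import Data.List.Membership.Propositional using (_∈_)
open import Data.List.Membership.Propositional.Properties using (∈-++⁻; ∈-++⁺ˡ; ∈-++⁺ʳ)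
open import Data.List.Properties using (++-identityʳ; ++-assoc)
open import Data.List.Relation.Unary.Any using (here)
open import Data.List.Relation.Binary.Sublist.Propositional using (_⊆_; ⊆-refl)
open import Data.List.Relation.Binary.Sublist.Propositional.Properties using (++⁺ˡ; ++⁺ʳ)
open import Data.Product using (_×_; _,_; proj₂)
open import Data.Sum using (inj₁; inj₂)
open import Relation.Nullary using (¬_)
open import Relation.Binary.PropositionalEquality using (refl; subst; sym)

CoherentSet : ∀ {n} → (Concl n → Set) → Set
CoherentSet X = ∀ d q → ¬ (X ⟨ plus , d , q ⟩ × X ⟨ minus , d , q ⟩)

module _ {n m : ℕ} {pres : Fin m → Concl n → Set} {cur : Concl n → Set}
         (pres-coherent : ∀ k → CoherentSet (pres k)) (cur-coherent : CoherentSet cur) where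

  Sem-sneg-disjoint : ∀ (A : Form n m) D q ρ
                    → Sem A pres cur D q ρ → ¬ Sem (sneg A) pres cur D q ρ
  Sem-sneg-disjoint (pure A)                D q ρ a b = b a
  Sem-sneg-disjoint (npure A)               D q ρ a b = a b
  Sem-sneg-disjoint (mem plus d t current)  D q ρ a b = cur-coherent d (t D q ρ) (a , b)
  Sem-sneg-disjoint (mem minus d t current) D q ρ a b = cur-coherent d (t D q ρ) (b , a)
  Sem-sneg-disjoint (mem plus d t (pre k))  D q ρ a b = pres-coherent k d (t D q ρ) (a , b)
  Sem-sneg-disjoint (mem minus d t (pre k)) D q ρ a b = pres-coherent k d (t D q ρ) (b , a)
  Sem-sneg-disjoint (nmem s d t X)          D q ρ a b = a b
  Sem-sneg-disjoint (and A B) D q ρ (a , _) (inj₁ b) = Sem-sneg-disjoint A D q ρ a b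
  Sem-sneg-disjoint (and A B) D q ρ (_ , a) (inj₂ b) = Sem-sneg-disjoint B D q ρ a b
  Sem-sneg-disjoint (or A B)  D q ρ (inj₁ a) (b , _) = Sem-sneg-disjoint A D q ρ a b
  Sem-sneg-disjoint (or A B)  D q ρ (inj₂ a) (_ , b) = Sem-sneg-disjoint B D q ρ a b
  Sem-sneg-disjoint (ex A)    D q ρ (v , a) b        = Sem-sneg-disjoint A D q (v ∷ ρ) a (b v)
  Sem-sneg-disjoint (all A)   D q ρ a (v , b)        = Sem-sneg-disjoint A D q (v ∷ ρ) (a v) b

module _ {n m : ℕ} (L : Logic n m) where
  open Logic L

  Holds-plus-minus-disjoint : StrongNegation L → ∀ {D} → (∀ k → CoherentSet (predef k D))
                            → ∀ {cur} → CoherentSet cur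
                            → ∀ d q → Holds L plus d D q cur → ¬ Holds L minus d D q cur
  Holds-plus-minus-disjoint sn {D} pres-coherent {cur} cur-coherent d q h⁺ h⁻ =
    Sem-sneg-disjoint pres-coherent cur-coherent (cond plus d) D q []
      h⁺ (subst (λ F → Sem F (λ k → predef k D) cur D q []) (sn d) h⁻)

  module _ (stable : ∀ s d → Stable L s d) {D : Theory} where

    Appendable-mono : ∀ {P Q c} → IsProof L D P → IsProof L D Q → P ⊆ Q
                    → Appendable L D P c → Appendable L D Q c
    Appendable-mono {P} {Q} {c} = stable (sign c) (tag c) D (lit c) P Q

    IsProof-++ : ∀ {P Q} → IsProof L D P → IsProof L D Q → IsProof L D (P ++ Q)
    IsProof-++ {P} p nil = subst (IsProof L D) (sym (++-identityʳ P)) p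
    IsProof-++ {P} p (snoc {Q} {c} q c-app) =
      subst (IsProof L D) (++-assoc P Q [ c ])
        (snoc p++q (Appendable-mono q p++q (++⁺ˡ P ⊆-refl) c-app))
      where p++q = IsProof-++ p q

    ∈-proof⇒Appendable : ∀ {P c} → IsProof L D P → c ∈ P → Appendable L D P c
    ∈-proof⇒Appendable nil ()
    ∈-proof⇒Appendable (snoc {P} {c} p c-app) c'∈ with ∈-++⁻ P c'∈
    ... | inj₁ c'∈P        =
      Appendable-mono p (snoc p c-app) (++⁺ʳ [ c ] ⊆-refl) (∈-proof⇒Appendable p c'∈P)
    ... | inj₂ (here refl) = Appendable-mono p (snoc p c-app) (++⁺ʳ [ c ] ⊆-refl) c-app

    module _ (sn : StrongNegation L) (pres-coherent : ∀ k → CoherentSet (predef k D)) where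

      IsProof⇒coherent : ∀ {P} → IsProof L D P → CoherentSet (_∈ P)
      IsProof⇒coherent nil d q (() , _)
      IsProof⇒coherent (snoc {P} p c-app) d q (c⁺∈ , c⁻∈) with ∈-++⁻ P c⁺∈ | ∈-++⁻ P c⁻∈
      ... | inj₁ c⁺∈P        | inj₁ c⁻∈P        = IsProof⇒coherent p d q (c⁺∈P , c⁻∈P)
      ... | inj₂ (here refl) | inj₁ c⁻∈P        =
        Holds-plus-minus-disjoint sn pres-coherent (IsProof⇒coherent p) d q
          c-app (∈-proof⇒Appendable p c⁻∈P)
      ... | inj₁ c⁺∈P        | inj₂ (here refl) =
        Holds-plus-minus-disjoint sn pres-coherent (IsProof⇒coherent p) d q
          (∈-proof⇒Appendable p c⁺∈P) c-app
      ... | inj₂ (here refl) | inj₂ (here ())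

theorem1 : ∀ {n m : _} (L : Logic n m) → WellBehaved L → Coherent L
theorem1 L (stable , sn , predef-closures) d _ D q ((P , p , +dq∈P) , (Q , q′ , -dq∈Q)) =
  IsProof⇒coherent L stable sn pres-coherent (IsProof-++ L stable p q′) d q
    (∈-++⁺ˡ +dq∈P , ∈-++⁺ʳ P -dq∈Q)
  where
  pres-coherent : ∀ k → CoherentSet (Logic.predef L k D)
  pres-coherent k = proj₂ (proj₂ (proj₂ (predef-closures k)) D)
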